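{- Let $P$ be a partially observable plant, $\beta$ a propositional formula over its state variables, and $D_\varphi$ the belief-automaton diagnoser for $\varphi=\mathrm{ExactDel}(A_\varphi,\beta,0)$. Let $\sigma$ be a trace of $D_\varphi\otimes P$ and $\sigma[i]=b\times s$. If $i$ is an observation point of $\sigma$, then $s\in b$.
   Context: A plant $P=\langle V^P,E^P,I^P,\mathcal T^P,E^P_o\rangle$ is a labeled transition system: finite set $V^P$ of state variables over a finite domain (finite state set $S$), events $E^P$, initial formula $I^P$, transition formulas $\mathcal T^P(e)$ over $V^P\cup V^{P\prime}$, observable events $E^P_o\subseteq E^P$. A trace is an infinite sequence $\sigma=s_0,e_0,s_1,e_1,\dots$ with $s_0$ initial and consecutive states related by the transition formula of the event in between; $\sigma[i]=s_i$. Position $i$ is an observation point of $\sigma$ iff $i>0$ and $e_{i-1}\in E^P_o$. Belief automaton: for $b\subseteq S$, $b^*$ is the least superset of $b$ closed under transitions labeled by events in $E^P\setminus E^P_o$; $b_0=\{s\mid s\models I^P\}$; $R(b,e)=\{s'\mid\exists s\in b^*.\ \langle s,s'\rangle\models\mathcal T^P(e)\}$ for $e\in E^P_o$. $D_\varphi$ is the LTS with events $E^P_o$, states the subsets $b\subseteq S$, initial state $b_0$, transitions $b\xrightarrow{e}R(b,e)$, and alarm variable $A_\varphi$ true in $b$ iff all $s\in b$ satisfy $\beta$. $D_\varphi\otimes P$ is the asynchronous product: states $b\times s$, initial states $b_0\times s_0$ with $s_0\models I^P$; on unobservable events only the plant moves; on observable $e$, $b\times s\to R(b,e)\times s'$ with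 $\langle s,s'\rangle\models\mathcal T^P(e)$. -}

module Defs where

open import Data.Nat using (ℕ; zero; suc)
open import Data.Fin using (Fin)
open import Data.Bool using (Bool; true; false)
open import Data.Product using (Σ; _×_; ∃-syntax)
open import Relation.Binary.PropositionalEquality using (_≡_)
open import Level using (0ℓ)

-- Its finite state set S (the valuations of the finitely many
-- finite-domain state variables) is enumerated as Fin nStates, its events as
-- Fin nEvents.  Propositional formulas over the state variables (resp. over
-- V ∪ V') are exactly Boolean functions of a state (resp. a pair of states).
record Plant : Set where
  field
    nStates  : ℕ
    nEvents  : ℕ
    Init     : Fin nStates → Bool
    Trans    : Fin nEvents → Fin nStates → Fin nStates → Bool
    Obs      : Fin nEvents → Bool

module _ (P : Plant) where
  open Plant P

  State : Set
  State = Fin nStates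

  Event : Set
  Event = Fin nEvents

  Belief : Set₁
  Belief = State → Set

  data Closure (b : Belief) : Belief where
    base : ∀ {s} → b s → Closure b s
    step : ∀ {s s'} (e : Event) → Closure b s → Obs e ≡ false →
           Trans e s s' ≡ true → Closure b s'

  b₀ : Belief
  b₀ s = Init s ≡ true

  R : Belief → Event → Belief
  R b e s' = Σ State (λ s → Closure b s × Trans e s s' ≡ true)

  -- alarm variable A_φ of D_φ for φ = ExactDel(A_φ, β, 0):
  -- true in b iff every s ∈ b satisfies β
  Alarm : (β : State → Bool) → Belief → Set
  Alarm β b = ∀ s → b s → β s ≡ true

  _≐_ : Belief → Belief → Set
  b ≐ c = ∀ s → (b s → c s) × (c s → b s)

  -- A trace of D_φ ⊗ P: σ[i] = belief i × state i, e_i = event i.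
  record ProductTrace : Set₁ where
    field
      belief : ℕ → Belief
      state  : ℕ → State
      event  : ℕ → Event
      init-belief : belief 0 ≐ b₀
      init-state  : Init (state 0) ≡ true
      plant-step  : ∀ i → Trans (event i) (state i) (state (suc i)) ≡ true
      unobs-step  : ∀ i → Obs (event i) ≡ false → belief (suc i) ≐ belief i
      obs-step    : ∀ i → Obs (event i) ≡ true →
                    belief (suc i) ≐ R (belief i) (event i)

  ObservationPoint : ProductTrace → ℕ → Set
  ObservationPoint σ zero    = Data.Empty.⊥
    where import Data.Empty
  ObservationPoint σ (suc j) = Obs (ProductTrace.event σ j) ≡ true

module Submission where

-- Every reachable product state b × s satisfies s ∈ b*: initially s ∈ b₀, an
-- unobservable step keeps b and extends the closure by the plant's move, and an
-- observable step puts s' into R(b, e) because s ∈ b*.  At an observation point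
-- the belief is R(b, e) itself, which therefore contains the current state.

open import Defs
open import Data.Nat using (ℕ; zero; suc)
open import Data.Bool using (Bool; true; false)
open import Data.Product using (_,_; proj₂)
open import Relation.Binary.PropositionalEquality using (_≡_)

module _ (P : Plant) where
  open Plant P

  Closure-mono : {b c : Belief P} → (∀ s → b s → c s) →
                 ∀ {s} → Closure P b s → Closure P c s
  Closure-mono b⊆c (base s∈b)            = base (b⊆c _ s∈b)
  Closure-mono b⊆c (step e s∈b* unobs t) = step e (Closure-mono b⊆c s∈b*) unobs t

  Closure-resp-≐ : {b c : Belief P} → _≐_ P b c →
                   ∀ {s} → Closure P c s → Closure P b s
  Closure-resp-≐ b≐c = Closure-mono (λ s → proj₂ (b≐c s))

  module _ (σ : ProductTrace P) where
    open ProductTrace σ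

    state∈belief-after-obs : ∀ j → Obs (event j) ≡ true →
                             Closure P (belief j) (state j) →
                             belief (suc j) (state (suc j))
    state∈belief-after-obs j obs s∈b* =
      proj₂ (obs-step j obs (state (suc j))) (state j , s∈b* , plant-step j)

    state∈closure-belief : ∀ j → Closure P (belief j) (state j)
    state∈closure-belief zero = base (proj₂ (init-belief (state 0)) init-state)
    state∈closure-belief (suc j) with Obs (event j) in obs
    ... | true  = base (state∈belief-after-obs j obs (state∈closure-belief j))
    ... | false = step (event j)
                    (Closure-resp-≐ (unobs-step j obs) (state∈closure-belief j))
                    obs (plant-step j)

lemma6p4 : (P : Plant) (β : State P → Bool) (σ : ProductTrace P) (i : ℕ) →
           ObservationPoint P σ i →
           ProductTrace.belief σ i (ProductTrace.state σ i)
lemma6p4 P β σ (suc j) obs =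
  state∈belief-after-obs P σ j obs (state∈closure-belief P σ j)
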